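{- Let $\mathcal M$ be a finite $\mathcal L$-structure with underlying set $M$, let $E\in\mathcal L$ have arity $n$, let $0<\varepsilon<\frac14$ and $1\le\ell\le n$. Let $A_0,\dots,A_{\ell-1}\in\hat M\setminus M$ be $(\varepsilon,\ell,E)$-good and let $A_\ell,\dots,A_{n-1}\in M$. Let $\sigma$ be a permutation of $\{0,\dots,n-1\}$ and define $C_0,\dots,C_{n-1}$ by $C_{\sigma(i)}:=A_i$. Then for any two bijections $\beta_0,\beta_1$ of $\{0,\dots,\ell-1\}$, writing $\sigma\circ\beta_s$ for the tuple $\langle\sigma(\beta_s(0)),\dots,\sigma(\beta_s(\ell-1))\rangle$, \[\hat E^{\sigma\circ\beta_0}_\varepsilon(C_0,\dots,C_{n-1})=\hat E^{\sigma\circ\beta_1}_\varepsilon(C_0,\dots,C_{n-1})\in\{\top,\bot\}.\]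
   Context: $\mathcal L$ is a finite relational language; $\hat M:=M\cup\mathcal P(M)$ (elements and subsets of $M$). $\top,\bot$ are truth values, $\uparrow$ means "indeterminate". $\varepsilon$-partial relations: for $0<\varepsilon<\frac12$, $E\in\mathcal L$ of arity $n$, and a tuple $\bar m$ of distinct elements of $\{0,\dots,n-1\}$, define $\hat E^{\bar m}_\varepsilon:\hat M^n\to\{\top,\bot,\uparrow\}$ by induction on the length of $\bar m$. Given $A_0,\dots,A_{n-1}\in\hat M$, let $S:=\{i:A_i\in\hat M\setminus M\}$. If $S\neq\mathrm{range}(\bar m)$, the value is $\uparrow$. If $\bar m=\emptyset$ (so all $A_i\in M$), the value is $\top$ if $\mathcal M\models E(A_0,\dots,A_{n-1})$ and $\bot$ otherwise. If $\bar m=\bar k^\frown j$ (last entry $j$), for $d\in\{\top,\bot\}$ let $A^d:=\{a\in A_j:\hat E^{\bar k}_\varepsilon(A_0,\dots,A_{j-1},a,A_{j+1},\dots,A_{n-1})=d\}$; the value is $\top$ if $|A^\top|/|A_j|>1-\varepsilon$, $\bot$ if $|A^\bot|/|A_j|>1-\varepsilon$, and $\uparrow$ otherwise. Goodness: $A\in\hat M$ is $(\varepsilon,0,E)$-good iff $A\in M$. For $1\le\ell\le n$, $A_0$ is $(\varepsilon,\ell,E)$-good iff $A_0$ is $(\varepsilon,k,E)$-good for all $1\le k<\ell$ and for all $A_1,\dots,A_{\ell-1}\in\hat M\setminus M$ with each $A_i$ $(\varepsilon,\ell-i,E)$-good, all $A_\ell,\dots,A_{n-1}\in M$, and all permutations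 $\sigma$ of $\{0,\dots,n-1\}$, letting $C_{\sigma(i)}:=A_i$, we have $\hat E^{\langle\sigma(\ell-1),\dots,\sigma(1),\sigma(0)\rangle}_\varepsilon(C_0,\dots,C_{n-1})\in\{\top,\bot\}$.
   Formalization: The parameter ε is taken over the rationals. -}

module Defs where

open import Data.Bool using (Bool; true; false; if_then_else_; _∧_; not)
open import Data.Nat as ℕ using (ℕ; zero; suc; _∸_)
import Data.Fin
open import Data.Fin using (Fin; toℕ; inject≤; _≟_)
open import Data.Fin.Subset using (Subset; ∣_∣)
open import Data.Fin.Permutation using (Permutation′; _⟨$⟩ʳ_; _⟨$⟩ˡ_)
open import Data.Vec using (lookup)
open import Data.List using (List; []; _∷_; reverse; map; filter; allFin; foldr)
open import Data.Bool.ListAction using (all; any)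
open import Data.Sum using (_⊎_; inj₁; inj₂)
open import Data.Maybe using (Maybe; just; nothing)
open import Data.Product using (_×_)
open import Data.Unit using (⊤)
open import Data.Empty using (⊥)
open import Data.Integer using (+_)
open import Data.Rational using (ℚ; _/_; _-_; _*_; _<_; 1ℚ)
open import Data.Rational.Properties using (_<?_)
open import Relation.Nullary.Decidable using (⌊_⌋; does)
open import Relation.Binary.PropositionalEquality using (_≡_)

record Language : Set where
  field
    nsym  : ℕ
    arity : Fin nsym → ℕ
open Language public

record Structure (L : Language) : Set where
  field
    size : ℕ
    rel  : (R : Fin (nsym L)) → (Fin (arity L R) → Fin size) → Bool
open Structure public

-- M̂ = M ∪ 𝒫(M): elements (inj₁) and subsets (inj₂).
HatM : ℕ → Set
HatM m = Fin m ⊎ Subset m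

IsElem : ∀ {m} → HatM m → Set
IsElem (inj₁ _) = ⊤
IsElem (inj₂ _) = ⊥

IsSet : ∀ {m} → HatM m → Set
IsSet (inj₁ _) = ⊥
IsSet (inj₂ _) = ⊤

data TV : Set where
  tt ff undet : TV

Determinate : TV → Set
Determinate tt = ⊤
Determinate ff = ⊤
Determinate undet = ⊥

isSetB : ∀ {m} → HatM m → Bool
isSetB (inj₁ _) = false
isSetB (inj₂ _) = true

elemB : ∀ {n} → Fin n → List (Fin n) → Bool
elemB i js = any (λ j → ⌊ i ≟ j ⌋) js

_==B_ : Bool → Bool → Bool
true ==B b = b
false ==B b = not b

-- S = range(ms), where S = { i : A i is a subset }
sameS : ∀ {m n} → List (Fin n) → (Fin n → HatM m) → Bool
sameS {n = n} ms A = all (λ i → isSetB (A i) ==B elemB i ms) (allFin n)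

elems : ∀ {m k} → (Fin k → HatM m) → Maybe (Fin k → Fin m)
elems {k = zero} A = just (λ ())
elems {k = suc k} A with A Data.Fin.zero | elems (λ i → A (Data.Fin.suc i))
... | inj₁ a | just f = just (λ { Data.Fin.zero → a ; (Data.Fin.suc i) → f i })
... | _ | _ = nothing

update : ∀ {m n} → (Fin n → HatM m) → Fin n → HatM m → (Fin n → HatM m)
update A j v i = if ⌊ i ≟ j ⌋ then v else A i

count : ∀ {m} → (Fin m → Bool) → ℕ
count {m} p = foldr (λ a c → if p a then suc c else c) 0 (allFin m)

isTT : TV → Bool
isTT tt = true
isTT _ = false

isFF : TV → Bool
isFF ff = true
isFF _ = false

ℕtoℚ : ℕ → ℚ
ℕtoℚ k = (+ k) / 1

-- k / c > 1 - ε, written multiplicatively as (1 - ε)·c < k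
-- (for c = |A_j| = 0 this is false, so the value is ↑).
exceeds : ℚ → ℕ → ℕ → Bool
exceeds ε k c = does (((1ℚ - ε) * ℕtoℚ c) <? ℕtoℚ k)

-- ε-partial relations Ê^{m̄}_ε.
-- evalRev takes the tuple m̄ REVERSED, so its head is the LAST entry j of m̄.

module _ {L : Language} (𝓜 : Structure L) (ε : ℚ) (E : Fin (nsym L)) where

  private
    n = arity L E
    m = size 𝓜

  evalRev : List (Fin n) → (Fin n → HatM m) → TV
  evalRev ks A with sameS ks A
  evalRev ks A | false = undet
  evalRev [] A | true with elems A
  ... | just a  = if rel 𝓜 E a then tt else ff
  ... | nothing = undet
  evalRev (j ∷ ks) A | true with A j
  ... | inj₁ _ = undet
  ... | inj₂ X =
    let cT = count (λ a → lookup X a ∧ isTT (evalRev ks (update A j (inj₁ a))))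
        cF = count (λ a → lookup X a ∧ isFF (evalRev ks (update A j (inj₁ a))))
    in if exceeds ε cT ∣ X ∣ then tt
       else if exceeds ε cF ∣ X ∣ then ff
       else undet

  hatE : List (Fin n) → (Fin n → HatM m) → TV
  hatE ms C = evalRev (reverse ms) C

  below : ℕ → List (Fin n)
  below ℓ = filter (λ i → toℕ i ℕ.<? ℓ) (allFin n)

  -- C_{σ(i)} := A_i, i.e. C = A ∘ σ⁻¹
  permute : Permutation′ n → (Fin n → HatM m) → (Fin n → HatM m)
  permute σ A c = A (σ ⟨$⟩ˡ c)

  -- (ε,ℓ,E)-goodness, defined by course-of-values recursion on ℓ.
  -- goodF fuel ℓ is the correct notion whenever ℓ ≤ fuel; Good ℓ = goodF ℓ ℓ.
  goodF : ℕ → ℕ → HatM m → Set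
  goodF _ zero A = IsElem A
  goodF zero (suc ℓ) A = ⊥     -- never used (fuel is always ≥ level)
  goodF (suc fuel) (suc ℓ') A =
    ((k : ℕ) → 1 ℕ.≤ k → k ℕ.< ℓ → goodF fuel k A)
    ×
    ((Â : Fin n → HatM m) →
     ((i : Fin n) → toℕ i ≡ 0 → Â i ≡ A) →
     ((i : Fin n) → 1 ℕ.≤ toℕ i → toℕ i ℕ.< ℓ → IsSet (Â i) × goodF fuel (ℓ ∸ toℕ i) (Â i)) →
     ((i : Fin n) → ℓ ℕ.≤ toℕ i → IsElem (Â i)) →
     (σ : Permutation′ n) →
     Determinate (hatE (reverse (map (σ ⟨$⟩ʳ_) (below ℓ))) (permute σ Â)))
    where ℓ = suc ℓ'

  Good : ℕ → HatM m → Set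
  Good ℓ A = goodF ℓ ℓ A

  compTuple : (ℓ : ℕ) → .(ℓ ℕ.≤ n) → Permutation′ n → Permutation′ ℓ → List (Fin n)
  compTuple ℓ ℓ≤n σ β = map (λ i → σ ⟨$⟩ʳ inject≤ (β ⟨$⟩ʳ i) ℓ≤n) (allFin ℓ)

-- Evaluating Ê^{m̄}_ε(C) means taking iterated ε-majority votes, one coordinate of m̄ at a time.
-- Goodness of the sets makes every such iterated vote, in every order, determinate. Two adjacent
-- votes can then be exchanged: if voting over X and then Y gave ⊤ while voting over Y and then X
-- gave ⊥, then, since ε < 1/4, more than 9/16 of the pairs in X × Y would have value ⊤ and more
-- than 9/16 value ⊥. As any two orders of the same coordinates differ by a sequence of adjacent
-- exchanges, all orders give the same determinate value.

module Submission where

open import Defs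
open import Data.Fin using (Fin)
open import Data.Rational using (ℚ)

module Counting where

  open import Data.Bool using (Bool; true; false; _∧_; if_then_else_)
  open import Data.Nat using (ℕ; zero; suc; _+_; _*_; _≤_; _<_; z≤n)
  open import Data.Nat.Properties
  open import Data.Nat.Solver using (module +-*-Solver)
  open import Algebra.Properties.Semiring.Sum +-*-semiring
    using (sum-syntax; ∑-comm; ∑-distrib-+; *-distribˡ-sum; *-distribʳ-sum; sum-cong-≗)
  open import Data.Fin using (Fin; zero; suc)
  open import Data.Fin.Subset using (Subset; ∣_∣)
  open import Data.Vec using (lookup; []; _∷_)
  open import Data.List using (foldr; tabulate)
  open import Data.Empty using (⊥)
  open import Function using (_∘_; flip)
  open import Relation.Binary.PropositionalEquality

  𝟙 : Bool → ℕ
  𝟙 true  = 1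
  𝟙 false = 0

  ∑-mono-≤ : ∀ {k} {f g : Fin k → ℕ} → (∀ i → f i ≤ g i) → ∑[ i < k ] f i ≤ ∑[ i < k ] g i
  ∑-mono-≤ {zero}  _   = z≤n
  ∑-mono-≤ {suc k} f≤g = +-mono-≤ (f≤g zero) (∑-mono-≤ (f≤g ∘ suc))

  count≡∑ : ∀ {m} (p : Fin m → Bool) → count p ≡ ∑[ a < m ] 𝟙 (p a)
  count≡∑ p = count-tabulate (λ a → a)
    where
    count-tabulate : ∀ {k} (f : Fin k → _) →
      foldr (λ a c → if p a then suc c else c) 0 (tabulate f) ≡ ∑[ i < k ] 𝟙 (p (f i))
    count-tabulate {zero} f = refl
    count-tabulate {suc k} f with p (f zero)
    ... | true  = cong suc (count-tabulate (f ∘ suc))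
    ... | false = count-tabulate (f ∘ suc)

  count-cong : ∀ {m} {p q : Fin m → Bool} → p ≗ q → count p ≡ count q
  count-cong {p = p} {q} p≗q = trans (count≡∑ p) (trans (sum-cong-≗ (cong 𝟙 ∘ p≗q)) (sym (count≡∑ q)))

  ∣∣≡∑ : ∀ {m} (X : Subset m) → ∣ X ∣ ≡ ∑[ a < m ] 𝟙 (lookup X a)
  ∣∣≡∑ []          = refl
  ∣∣≡∑ (true ∷ X)  = cong suc (∣∣≡∑ X)
  ∣∣≡∑ (false ∷ X) = ∣∣≡∑ X

  ThreeQuarters : ∀ {m} → Subset m → (Fin m → Bool) → Set
  ThreeQuarters X p = 3 * ∣ X ∣ < 4 * count (λ a → lookup X a ∧ p a)

  pairs : ∀ {m m′} → Subset m → Subset m′ → (Fin m → Fin m′ → Bool) → ℕ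
  pairs {m} {m′} X Y r = ∑[ a < m ] ∑[ b < m′ ] 𝟙 (lookup X a ∧ lookup Y b ∧ r a b)

  pairs-flip : ∀ {m m′} (X : Subset m) (Y : Subset m′) r → pairs Y X (flip r) ≡ pairs X Y r
  pairs-flip {m} {m′} X Y r = begin
    pairs Y X (flip r)
      ≡⟨ ∑-comm (λ b a → 𝟙 (lookup Y b ∧ lookup X a ∧ r a b)) ⟩
    ∑[ a < m ] ∑[ b < m′ ] 𝟙 (lookup Y b ∧ lookup X a ∧ r a b)
      ≡⟨ sum-cong-≗ (λ a → sum-cong-≗ (λ b → cong 𝟙 (∧-swap (lookup Y b) (lookup X a) (r a b)))) ⟩
    pairs X Y r ∎
    where
    open ≡-Reasoning
    ∧-swap : ∀ x y z → x ∧ y ∧ z ≡ y ∧ x ∧ z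
    ∧-swap true  true  _ = refl
    ∧-swap true  false _ = refl
    ∧-swap false true  _ = refl
    ∧-swap false false _ = refl

  -- More than 3/4·|X| rows, each containing more than 3/4·|Y| pairs.
  pairs-lower-bound : ∀ {m m′} (X : Subset m) (Y : Subset m′) (r : Fin m → Fin m′ → Bool)
    (G : Fin m → Bool) →
    ThreeQuarters X G → (∀ a → G a ≡ true → ThreeQuarters Y (r a)) →
    (3 * ∣ X ∣ + 1) * (3 * ∣ Y ∣ + 1) ≤ 16 * pairs X Y r
  pairs-lower-bound {m} {m′} X Y r G most-rows row⇒most = begin
    (3 * ∣ X ∣ + 1) * (3 * ∣ Y ∣ + 1)
      ≤⟨ *-monoˡ-≤ (3 * ∣ Y ∣ + 1) (≤-trans (≤-reflexive (+-comm _ 1)) most-rows) ⟩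
    4 * rows * (3 * ∣ Y ∣ + 1)
      ≡⟨ *-assoc 4 rows (3 * ∣ Y ∣ + 1) ⟩
    4 * (rows * (3 * ∣ Y ∣ + 1))
      ≡⟨ cong (λ c → 4 * (c * (3 * ∣ Y ∣ + 1))) (count≡∑ (λ a → lookup X a ∧ G a)) ⟩
    4 * ((∑[ a < m ] 𝟙 (lookup X a ∧ G a)) * (3 * ∣ Y ∣ + 1))
      ≡⟨ cong (4 *_) (*-distribʳ-sum (3 * ∣ Y ∣ + 1) (λ a → 𝟙 (lookup X a ∧ G a))) ⟩
    4 * ∑[ a < m ] (𝟙 (lookup X a ∧ G a) * (3 * ∣ Y ∣ + 1))
      ≤⟨ *-monoʳ-≤ 4 (∑-mono-≤ row) ⟩
    4 * ∑[ a < m ] (4 * row-pairs a)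
      ≡⟨ cong (4 *_) (sym (*-distribˡ-sum 4 row-pairs)) ⟩
    4 * (4 * pairs X Y r)
      ≡⟨ sym (*-assoc 4 4 (pairs X Y r)) ⟩
    16 * pairs X Y r ∎
    where
    open ≤-Reasoning
    rows : ℕ
    rows = count (λ a → lookup X a ∧ G a)
    row-pairs : Fin m → ℕ
    row-pairs a = ∑[ b < m′ ] 𝟙 (lookup X a ∧ lookup Y b ∧ r a b)
    row : ∀ a → 𝟙 (lookup X a ∧ G a) * (3 * ∣ Y ∣ + 1) ≤ 4 * row-pairs a
    row a with lookup X a | G a in selected
    ... | false | _     = z≤n
    ... | true  | false = z≤n
    ... | true  | true  = begin
      3 * ∣ Y ∣ + 1 + 0                       ≡⟨ +-identityʳ _ ⟩
      3 * ∣ Y ∣ + 1                           ≡⟨ +-comm _ 1 ⟩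
      suc (3 * ∣ Y ∣)                         ≤⟨ row⇒most a selected ⟩
      4 * count (λ b → lookup Y b ∧ r a b)    ≡⟨ cong (4 *_) (count≡∑ (λ b → lookup Y b ∧ r a b)) ⟩
      4 * ∑[ b < m′ ] 𝟙 (lookup Y b ∧ r a b)  ∎

  pairs-disjoint : ∀ {m m′} (X : Subset m) (Y : Subset m′) (p q : Fin m → Fin m′ → Bool) →
    (∀ a b → p a b ∧ q a b ≡ false) → pairs X Y p + pairs X Y q ≤ ∣ X ∣ * ∣ Y ∣
  pairs-disjoint {m} {m′} X Y p q disjoint = begin
    pairs X Y p + pairs X Y q
      ≡⟨ sym (∑-distrib-+ (row p) (row q)) ⟩
    ∑[ a < m ] (row p a + row q a)
      ≡⟨ sum-cong-≗ (λ a → sym (∑-distrib-+ (cell p a) (cell q a))) ⟩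
    ∑[ a < m ] ∑[ b < m′ ] (cell p a b + cell q a b)
      ≤⟨ ∑-mono-≤ (λ a → ∑-mono-≤ (at-most-one a)) ⟩
    ∑[ a < m ] ∑[ b < m′ ] (𝟙 (lookup X a) * 𝟙 (lookup Y b))
      ≡⟨ sum-cong-≗ (λ a → sym (*-distribˡ-sum (𝟙 (lookup X a)) (𝟙 ∘ lookup Y))) ⟩
    ∑[ a < m ] (𝟙 (lookup X a) * ∑[ b < m′ ] 𝟙 (lookup Y b))
      ≡⟨ sym (*-distribʳ-sum (∑[ b < m′ ] 𝟙 (lookup Y b)) (𝟙 ∘ lookup X)) ⟩
    (∑[ a < m ] 𝟙 (lookup X a)) * (∑[ b < m′ ] 𝟙 (lookup Y b))
      ≡⟨ sym (cong₂ _*_ (∣∣≡∑ X) (∣∣≡∑ Y)) ⟩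
    ∣ X ∣ * ∣ Y ∣ ∎
    where
    open ≤-Reasoning
    cell : (Fin m → Fin m′ → Bool) → Fin m → Fin m′ → ℕ
    cell r a b = 𝟙 (lookup X a ∧ lookup Y b ∧ r a b)
    row : (Fin m → Fin m′ → Bool) → Fin m → ℕ
    row r a = ∑[ b < m′ ] cell r a b
    at-most-one : ∀ a b → cell p a b + cell q a b ≤ 𝟙 (lookup X a) * 𝟙 (lookup Y b)
    at-most-one a b with lookup X a | lookup Y b | p a b | q a b | disjoint a b
    ... | false | _     | _     | _     | _ = z≤n
    ... | true  | false | _     | _     | _ = z≤n
    ... | true  | true  | false | false | _ = z≤n
    ... | true  | true  | false | true  | _ = ≤-refl
    ... | true  | true  | true  | false | _ = ≤-refl

  -- Otherwise 2(3x+1)(3y+1) ≤ 16·(pairs X Y p + pairs X Y q) ≤ 16xy for x = |X|, y = |Y|.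
  ThreeQuarters-exchange : ∀ {m m′} (X : Subset m) (Y : Subset m′) (p q : Fin m → Fin m′ → Bool)
    (G : Fin m → Bool) (H : Fin m′ → Bool) → (∀ a b → p a b ∧ q a b ≡ false) →
    ThreeQuarters X G → (∀ a → G a ≡ true → ThreeQuarters Y (p a)) →
    ThreeQuarters Y H → (∀ b → H b ≡ true → ThreeQuarters X (λ a → q a b)) → ⊥
  ThreeQuarters-exchange X Y p q G H disjoint most-G G⇒most most-H H⇒most = <⇒≱ too-many (begin
    2 * ((3 * x + 1) * (3 * y + 1))
      ≡⟨ solve 2 (λ x y → con 2 :* ((con 3 :* x :+ con 1) :* (con 3 :* y :+ con 1))
                 := (con 3 :* x :+ con 1) :* (con 3 :* y :+ con 1) :+ (con 3 :* y :+ con 1) :* (con 3 :* x :+ con 1))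
               refl x y ⟩
    (3 * x + 1) * (3 * y + 1) + (3 * y + 1) * (3 * x + 1)
      ≤⟨ +-mono-≤ (pairs-lower-bound X Y p G most-G G⇒most) (pairs-lower-bound Y X (flip q) H most-H H⇒most) ⟩
    16 * pairs X Y p + 16 * pairs Y X (flip q)
      ≡⟨ cong (λ c → 16 * pairs X Y p + 16 * c) (pairs-flip X Y q) ⟩
    16 * pairs X Y p + 16 * pairs X Y q
      ≡⟨ sym (*-distribˡ-+ 16 (pairs X Y p) (pairs X Y q)) ⟩
    16 * (pairs X Y p + pairs X Y q)
      ≤⟨ *-monoʳ-≤ 16 (pairs-disjoint X Y p q disjoint) ⟩
    16 * (x * y) ∎)
    where
    open ≤-Reasoning
    open +-*-Solver using (solve; con; _:*_; _:+_; _:=_)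
    x y : ℕ
    x = ∣ X ∣
    y = ∣ Y ∣
    too-many : 16 * (x * y) < 2 * ((3 * x + 1) * (3 * y + 1))
    too-many = ≤-trans (m≤m+n (suc (16 * (x * y))) (2 * (x * y) + 6 * x + 6 * y + 1))
      (≤-reflexive (solve 2 (λ x y →
          con 1 :+ con 16 :* (x :* y) :+ (con 2 :* (x :* y) :+ con 6 :* x :+ con 6 :* y :+ con 1)
            := con 2 :* ((con 3 :* x :+ con 1) :* (con 3 :* y :+ con 1)))
        refl x y))

module Threshold where

  open import Data.Bool using (true)
  import Data.Nat as ℕ
  open import Data.Integer using (+_)
  import Data.Nat.Properties as ℕ
  import Data.Integer as ℤ
  import Data.Integer.Properties as ℤ
  open import Data.Rational using (ℚ; 1ℚ; mkℚ; _/_; _<_; _-_; _*_)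
  open import Data.Rational.Properties
  import Data.Rational.Unnormalised.Properties as ℚᵘ
  open import Data.Nat.Coprimality using (1-coprimeTo; sym)
  open import Relation.Nullary.Decidable using (Dec; yes; does)
  open import Relation.Binary.PropositionalEquality using (_≡_; cong; subst₂; trans)

  does-sound : ∀ {P : Set} (P? : Dec P) → does P? ≡ true → P
  does-sound (yes p) _ = p

  -- Since ε < 1/4, a fraction above 1 - ε is a fraction above 3/4.
  exceeds⇒three-quarters : ∀ {ε} → ε < (+ 1) / 4 →
    ∀ k c → exceeds ε k c ≡ true → 3 ℕ.* c ℕ.< 4 ℕ.* k
  exceeds⇒three-quarters {ε} ε<¼ k c exceeded = ℤ.drop‿+<+ (subst₂ ℤ._<_
    (trans (ℤ.*-identityʳ _) (ℤ.+◃n≡+n (3 ℕ.* c)))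
    (trans (ℤ.+◃n≡+n (k ℕ.* 4)) (cong +_ (ℕ.*-comm k 4)))
    (ℚᵘ.drop-*<* (ℚᵘ.<-respˡ-≃ (toℚᵘ-homo-* ((+ 3) / 4) c′) (toℚᵘ-mono-< ¾c<k))))
    where
    whole : ∀ j → ℕtoℚ j ≡ mkℚ (+ j) 0 (sym (1-coprimeTo j))
    whole j = normalize-coprime (sym (1-coprimeTo j))
    c′ k′ : ℚ
    c′ = mkℚ (+ c) 0 (sym (1-coprimeTo c))
    k′ = mkℚ (+ k) 0 (sym (1-coprimeTo k))
    ¾<1-ε : (+ 3) / 4 < 1ℚ - ε
    ¾<1-ε = +-monoʳ-< 1ℚ (neg-antimono-< ε<¼)
    ¾c<k : (+ 3) / 4 * c′ < k′
    ¾c<k = ≤-<-trans (*-monoʳ-≤-nonNeg c′ (<⇒≤ ¾<1-ε)) (subst₂ (λ x y → (1ℚ - ε) * x < y) (whole c) (whole k)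
      (does-sound ((1ℚ - ε) * ℕtoℚ c <? ℕtoℚ k) exceeded))

module FinPermutations where

  open import Data.Nat using (zero; suc; _+_; _≤_; _<_; z≤n; s≤s; _<?_)
  open import Data.Nat.Properties hiding (_≟_)
  open import Data.Fin using (Fin; zero; suc; toℕ; _≟_; inject≤; inject₁; fromℕ; fromℕ<)
  open import Data.Fin.Properties
    using (toℕ-injective; toℕ-inject≤; toℕ-inject₁; toℕ-fromℕ; toℕ-fromℕ<; toℕ<n; inject₁-injective; fromℕ≢inject₁)
  open import Data.Fin.Relation.Unary.Top using (view; ‵fromℕ; ‵inj₁)
  open import Data.Fin.Permutation as Perm using (Permutation′; _⟨$⟩ʳ_; _⟨$⟩ˡ_; _∘ₚ_; transpose; inverseˡ)
  open import Data.List using (List; _∷_; filter; tabulate; length; lookup)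
  open import Data.List.Properties using (filter-none; filter-accept)
  import Data.List.Relation.Unary.All as All
  import Data.List.Relation.Unary.All.Properties as All
  import Data.List.Relation.Unary.Any as Any
  open import Data.List.Relation.Unary.Any.Properties using (lookup-index)
  open import Data.List.Membership.Propositional using (_∈_)
  open import Data.List.Membership.Propositional.Properties using (∈-lookup)
  open import Data.List.Relation.Unary.Unique.Propositional using (Unique; _∷_)
  open import Data.Product using (Σ; _,_; proj₁; proj₂)
  open import Function using (_∘_; _⇔_; mk⇔)
  open import Relation.Nullary using (contradiction)
  open import Relation.Nullary.Decidable using (dec-true; dec-false)
  open import Relation.Binary.PropositionalEquality

  ⟨$⟩ʳ-injective : ∀ {n} (π : Permutation′ n) {i j} → π ⟨$⟩ʳ i ≡ π ⟨$⟩ʳ j → i ≡ j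
  ⟨$⟩ʳ-injective π {i} {j} eq = begin
    i                     ≡⟨ inverseˡ π ⟨
    π ⟨$⟩ˡ (π ⟨$⟩ʳ i)     ≡⟨ cong (π ⟨$⟩ˡ_) eq ⟩
    π ⟨$⟩ˡ (π ⟨$⟩ʳ j)     ≡⟨ inverseˡ π ⟩
    j                     ∎
    where open ≡-Reasoning

  transpose-sends : ∀ {n} (i j : Fin n) → transpose i j ⟨$⟩ʳ i ≡ j
  transpose-sends i j rewrite dec-true (i ≟ i) refl = refl

  transpose-fixes : ∀ {n} {i j k : Fin n} → k ≢ i → k ≢ j → transpose i j ⟨$⟩ʳ k ≡ k
  transpose-fixes {i = i} {j} {k} k≢i k≢j rewrite dec-false (k ≟ i) k≢i | dec-false (k ≟ j) k≢j = refl

  toℕ-inject≤-< : ∀ {K n} (t : Fin K) .(K≤n : K ≤ n) → toℕ (inject≤ t K≤n) < K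
  toℕ-inject≤-< t K≤n = subst (_< _) (sym (toℕ-inject≤ t K≤n)) (toℕ<n t)

  inject≤-fromℕ< : ∀ {K n} (i : Fin n) (i<K : toℕ i < K) .(K≤n : K ≤ n) → inject≤ (fromℕ< i<K) K≤n ≡ i
  inject≤-fromℕ< i i<K K≤n = toℕ-injective (trans (toℕ-inject≤ (fromℕ< i<K) K≤n) (toℕ-fromℕ< i<K))

  -- Adding one point at a time, the transposition moving ρ's image of the new point to its target
  -- does not disturb the points already placed.
  extend-injection : ∀ {K n} (K≤n : K ≤ n) (f : Fin K → Fin n) → (∀ {s t} → f s ≡ f t → s ≡ t) →
    Σ (Permutation′ n) λ ρ → ∀ t → ρ ⟨$⟩ʳ inject≤ t K≤n ≡ f t
  extend-injection {zero} _ _ _ = Perm.id , λ ()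
  extend-injection {suc K} {n} 1+K≤n f f-injective = ρ ∘ₚ transpose p q , extends
    where
    K≤n : K ≤ n
    K≤n = ≤-trans (n≤1+n K) 1+K≤n
    IH : Σ (Permutation′ n) λ ρ → ∀ t → ρ ⟨$⟩ʳ inject≤ t K≤n ≡ f (inject₁ t)
    IH = extend-injection K≤n (f ∘ inject₁) (inject₁-injective ∘ f-injective)
    ρ : Permutation′ n
    ρ = proj₁ IH
    p q : Fin n
    p = ρ ⟨$⟩ʳ inject≤ (fromℕ K) 1+K≤n
    q = f (fromℕ K)
    extends : ∀ t → transpose p q ⟨$⟩ʳ (ρ ⟨$⟩ʳ inject≤ t 1+K≤n) ≡ f t
    extends t with view t
    ... | ‵fromℕ = transpose-sends p q
    ... | ‵inj₁ {i = t′} _ = trans (cong (transpose p q ⟨$⟩ʳ_) ρt≡ft) (transpose-fixes ft≢p ft≢q)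
      where
      same-point : inject≤ (inject₁ t′) 1+K≤n ≡ inject≤ t′ K≤n
      same-point = toℕ-injective
        (trans (toℕ-inject≤ _ 1+K≤n) (trans (toℕ-inject₁ t′) (sym (toℕ-inject≤ t′ K≤n))))
      ρt≡ft : ρ ⟨$⟩ʳ inject≤ (inject₁ t′) 1+K≤n ≡ f (inject₁ t′)
      ρt≡ft = trans (cong (ρ ⟨$⟩ʳ_) same-point) (proj₂ IH t′)
      ft≢q : f (inject₁ t′) ≢ q
      ft≢q eq = fromℕ≢inject₁ (sym (f-injective eq))
      ft≢p : f (inject₁ t′) ≢ p
      ft≢p eq = <⇒≢ (toℕ<n t′) (begin
        toℕ t′                                ≡⟨ toℕ-inject≤ t′ K≤n ⟨
        toℕ (inject≤ t′ K≤n)                  ≡⟨ cong toℕ (⟨$⟩ʳ-injective ρ (trans (proj₂ IH t′) eq)) ⟩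
        toℕ (inject≤ (fromℕ K) 1+K≤n)         ≡⟨ toℕ-inject≤ (fromℕ K) 1+K≤n ⟩
        toℕ (fromℕ K)                         ≡⟨ toℕ-fromℕ K ⟩
        K                                     ∎)
        where open ≡-Reasoning

  extends-∈⇔ : ∀ {n} {ks : List (Fin n)} (ks≤n : length ks ≤ n) (ρ : Permutation′ n) →
    (∀ t → ρ ⟨$⟩ʳ inject≤ t ks≤n ≡ lookup ks t) → ∀ i → ρ ⟨$⟩ʳ i ∈ ks ⇔ toℕ i < length ks
  extends-∈⇔ {ks = ks} ks≤n ρ extends i = mk⇔ in-front at-front
    where
    in-front : ρ ⟨$⟩ʳ i ∈ ks → toℕ i < length ks
    in-front ρi∈ks = subst (_< length ks) (cong toℕ (sym i≡t)) (toℕ-inject≤-< (Any.index ρi∈ks) ks≤n)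
      where
      i≡t : i ≡ inject≤ (Any.index ρi∈ks) ks≤n
      i≡t = ⟨$⟩ʳ-injective ρ (trans (lookup-index ρi∈ks) (sym (extends (Any.index ρi∈ks))))
    at-front : toℕ i < length ks → ρ ⟨$⟩ʳ i ∈ ks
    at-front i<ks = subst (_∈ ks) (trans (sym (extends _)) (cong (ρ ⟨$⟩ʳ_) (inject≤-fromℕ< i i<ks ks≤n)))
      (∈-lookup (fromℕ< i<ks))

  lookup-injective : ∀ {A : Set} {xs : List A} → Unique xs → ∀ {s t} → lookup xs s ≡ lookup xs t → s ≡ t
  lookup-injective (_ ∷ _) {zero} {zero} _ = refl
  lookup-injective (x≢xs ∷ _) {zero} {suc t} eq = contradiction eq (All.lookup x≢xs (∈-lookup t))
  lookup-injective (x≢xs ∷ _) {suc s} {zero} eq = contradiction (sym eq) (All.lookup x≢xs (∈-lookup s))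
  lookup-injective (_ ∷ xs!) {suc s} {suc t} eq = cong suc (lookup-injective xs! eq)

  filter-<-tabulate : ∀ {k N} (g : Fin k → Fin N) d K (K≤k : K ≤ k) → (∀ i → toℕ (g i) ≡ d + toℕ i) →
    filter (λ i → toℕ i <? d + K) (tabulate g) ≡ tabulate (λ t → g (inject≤ t K≤k))
  filter-<-tabulate {zero} g d zero z≤n _ = refl
  filter-<-tabulate {suc k} g d zero _ offset rewrite +-identityʳ d =
    filter-none (λ i → toℕ i <? d)
      (All.tabulate⁺ (λ i → ≤⇒≯ (subst (d ≤_) (sym (offset i)) (m≤m+n d (toℕ i)))))
  filter-<-tabulate {suc k} g d (suc K) (s≤s K≤k) offset rewrite +-suc d K = trans
    (filter-accept (λ i → toℕ i <? suc d + K) (s≤s (subst (_≤ d + K) (sym (offset zero)) (+-monoʳ-≤ d z≤n))))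
    (cong (g zero ∷_) (filter-<-tabulate (g ∘ suc) (suc d) K K≤k (λ i → trans (offset (suc i)) (+-suc d (toℕ i)))))

module Tuples where

  open import Data.Bool using (true; false; T)
  open import Data.Bool.Properties using (T-≡)
  open import Data.Bool.ListAction using (and)
  open import Data.Nat using (ℕ; zero; suc; _≤_; _<_; _<?_)
  open import Data.Nat.Properties using (≤-trans; n≤1+n; ≮⇒≥)
  open import Data.Fin using (Fin; zero; suc; toℕ; _≟_)
  open import Data.List using (List; _∷_; map; allFin; length)
  open import Data.List.Properties using (map-cong)
  open import Data.List.Membership.Propositional using (_∈_; _∉_)
  open import Data.List.Relation.Unary.Any as Any using (here; there)
  open import Data.List.Relation.Unary.Any.Properties using (any⇔)
  import Data.List.Relation.Unary.All.Properties as All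
  open import Data.List.Relation.Unary.Unique.Propositional as Unique using (Unique)
  open import Data.List.Relation.Unary.Unique.Propositional.Properties using (Unique[x∷xs]⇒x∉xs)
  open import Data.List.Relation.Binary.Permutation.Propositional using (_↭_; ↭-sym; ↭⇒↭ₛ)
  open import Data.List.Relation.Binary.Permutation.Propositional.Properties using (∈-resp-↭; ↭-length)
  import Data.List.Relation.Binary.Permutation.Setoid.Properties as ↭ₛ
  open import Data.Maybe using (just; nothing)
  open import Data.Product using (∃; _,_)
  open import Data.Sum using (inj₁; inj₂)
  open import Data.Unit using (tt)
  open import Function using (_∘_; _⇔_; mk⇔; Equivalence)
  import Function.Properties.Equivalence as ⇔
  open import Relation.Nullary using (¬_; yes; no; contradiction)
  open import Relation.Nullary.Decidable using (toWitness; fromWitness; decidable-stable)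
  open import Relation.Binary.PropositionalEquality

  private
    variable
      m n : ℕ

  T-elemB : ∀ {i : Fin n} {js} → T (elemB i js) ⇔ i ∈ js
  T-elemB = ⇔.trans (⇔.sym any⇔) (mk⇔ (Any.map toWitness) (Any.map fromWitness))

  T-isSetB : (v : HatM m) → T (isSetB v) ⇔ IsSet v
  T-isSetB (inj₁ _) = ⇔.refl
  T-isSetB (inj₂ _) = ⇔.refl

  T-==B : ∀ {b c} → T b ⇔ T c → T (b ==B c)
  T-==B {true}  {true}  _   = tt
  T-==B {true}  {false} b⇔c = Equivalence.to b⇔c tt
  T-==B {false} {true}  b⇔c = Equivalence.from b⇔c tt
  T-==B {false} {false} _   = tt

  ¬IsSet⇒IsElem : (v : HatM m) → ¬ IsSet v → IsElem v
  ¬IsSet⇒IsElem (inj₁ _) _    = tt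
  ¬IsSet⇒IsElem (inj₂ _) ¬set = ¬set tt

  IsElem⇒¬IsSet : (v : HatM m) → IsElem v → ¬ IsSet v
  IsElem⇒¬IsSet (inj₁ _) _ ()

  IsSet⇒subset : (v : HatM m) → IsSet v → ∃ λ X → v ≡ inj₂ X
  IsSet⇒subset (inj₂ X) _ = X , refl

  elems-cong : ∀ {k} {A B : Fin k → HatM m} → A ≗ B → elems A ≡ elems B
  elems-cong {k = zero} _ = refl
  elems-cong {k = suc k} {A = A} {B} A≗B
    with A zero | B zero | A≗B zero | elems (A ∘ suc) | elems (B ∘ suc)
       | elems-cong {A = A ∘ suc} {B ∘ suc} (A≗B ∘ suc)
  ... | inj₁ _ | _ | refl | just _  | _ | refl = refl
  ... | inj₁ _ | _ | refl | nothing | _ | refl = refl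
  ... | inj₂ _ | _ | refl | _       | _ | refl = refl

  elems-total : ∀ {k} (A : Fin k → HatM m) → (∀ i → ¬ IsSet (A i)) → ∃ λ f → elems A ≡ just f
  elems-total {k = zero} _ _ = _ , refl
  elems-total {k = suc k} A no-set
    with A zero | no-set zero | elems (A ∘ suc) | elems-total (A ∘ suc) (no-set ∘ suc)
  ... | inj₁ _ | _    | _ | _ , refl = _ , refl
  ... | inj₂ _ | ¬set | _ | _        = contradiction tt ¬set

  update-≢ : ∀ (C : Fin n → HatM m) {j i} v → i ≢ j → update C j v i ≡ C i
  update-≢ C {j} {i} v i≢j with i ≟ j
  ... | yes i≡j = contradiction i≡j i≢j
  ... | no _    = refl

  update-cong : ∀ {C D : Fin n → HatM m} j v → C ≗ D → update C j v ≗ update D j v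
  update-cong j v C≗D i with i ≟ j
  ... | yes _ = refl
  ... | no _  = C≗D i

  update-comm : ∀ (C : Fin n → HatM m) {x y} u w → x ≢ y → update (update C x u) y w ≗ update (update C y w) x u
  update-comm C {x} {y} u w x≢y i with i ≟ x | i ≟ y
  ... | yes refl | yes refl = contradiction refl x≢y
  ... | yes refl | no _     = refl
  ... | no _     | yes refl = refl
  ... | no _     | no _     = refl

  -- The paper's condition S = range(m̄), under which Ê^{m̄} is not ↑.
  SetPositions : List (Fin n) → (Fin n → HatM m) → Set
  SetPositions ks C = ∀ i → i ∈ ks ⇔ IsSet (C i)

  sameS-true : ∀ {ks} {C : Fin n → HatM m} → SetPositions ks C → sameS ks C ≡ true
  sameS-true {C = C} sp = Equivalence.to T-≡ (All.all⁻ _ (All.tabulate⁺ (λ i →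
    T-==B (⇔.trans (T-isSetB (C i)) (⇔.trans (⇔.sym (sp i)) (⇔.sym T-elemB))))))

  sameS-cong : ∀ ks {C D : Fin n → HatM m} → C ≗ D → sameS ks C ≡ sameS ks D
  sameS-cong {n} ks C≗D = cong and (map-cong (λ i → cong (λ v → isSetB v ==B elemB i ks) (C≗D i)) (allFin n))

  SetPositions-head : ∀ {j ks} {C : Fin n → HatM m} → SetPositions (j ∷ ks) C → ∃ λ X → C j ≡ inj₂ X
  SetPositions-head {j = j} {C = C} sp = IsSet⇒subset (C j) (Equivalence.to (sp j) (here refl))

  SetPositions-update : ∀ {j ks} {C : Fin n → HatM m} → SetPositions (j ∷ ks) C → j ∉ ks →
    ∀ a → SetPositions ks (update C j (inj₁ a))
  SetPositions-update {j = j} sp j∉ks a i with i ≟ j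
  ... | yes refl = mk⇔ j∉ks (λ ())
  ... | no i≢j   = ⇔.trans (mk⇔ there (Any.tail i≢j)) (sp i)

  record Admissible (K : ℕ) (C : Fin n → HatM m) (ks : List (Fin n)) : Set where
    field
      unique    : Unique ks
      positions : SetPositions ks C
      bounded   : length ks ≤ K

  open Admissible public

  Admissible-tail : ∀ {K j ks} {C : Fin n → HatM m} → Admissible K C (j ∷ ks) →
    ∀ a → Admissible K (update C j (inj₁ a)) ks
  Admissible-tail adm a = record
    { unique    = Unique.tail (unique adm)
    ; positions = SetPositions-update (positions adm) (Unique[x∷xs]⇒x∉xs (unique adm)) a
    ; bounded   = ≤-trans (n≤1+n _) (bounded adm)
    }

  Admissible-↭ : ∀ {K ks ks′} {C : Fin n → HatM m} → ks ↭ ks′ → Admissible K C ks → Admissible K C ks′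
  Admissible-↭ {n} {K = K} ks↭ks′ adm = record
    { unique    = ↭ₛ.Unique-resp-↭ (setoid (Fin n)) (↭⇒↭ₛ ks↭ks′) (unique adm)
    ; positions = λ i → ⇔.trans (mk⇔ (∈-resp-↭ (↭-sym ks↭ks′)) (∈-resp-↭ ks↭ks′)) (positions adm i)
    ; bounded   = subst (_≤ K) (↭-length ks↭ks′) (bounded adm)
    }

  IsSet⇔front : ∀ {ℓ} {A : Fin n → HatM m} →
    (∀ i → toℕ i < ℓ → IsSet (A i)) → (∀ i → ℓ ≤ toℕ i → IsElem (A i)) → ∀ i → IsSet (A i) ⇔ toℕ i < ℓ
  IsSet⇔front {ℓ = ℓ} {A} front back i = mk⇔
    (λ set → decidable-stable (toℕ i <? ℓ) (λ i≮ℓ → IsElem⇒¬IsSet (A i) (back i (≮⇒≥ i≮ℓ)) set))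
    (front i)

module Evaluation {L : Language} (𝓜 : Structure L) (ε : ℚ) (E : Fin (nsym L)) where

  open import Data.Bool using (true; false; _∧_; if_then_else_)
  open import Data.Nat using (ℕ; zero; suc; _*_; _∸_; _≤_; _<_; z≤n; s≤s)
  open import Data.Nat.Properties
    using (≤-refl; ≤-reflexive; ≤-trans; ≤-pred; ∸-monoʳ-≤; m≤n⇒m<n∨m≡n; m<n⇒0<n∸m; m∸n≤m; <⇒≱)
  open import Data.Fin using (Fin; zero; toℕ; _≟_; inject≤; fromℕ<)
  open import Data.Fin.Properties using (toℕ-injective; toℕ-inject≤; inject≤-injective)
  open import Data.Fin.Subset using (Subset; ∣_∣)
  open import Data.Fin.Permutation using (Permutation′; _⟨$⟩ʳ_; _⟨$⟩ˡ_; inverseˡ; inverseʳ)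
  open import Data.Vec using (lookup)
  open import Data.List as List using (List; []; _∷_; map; allFin; length; tabulate; reverse)
  open import Data.List.Properties
    using (map-tabulate; tabulate-cong; tabulate-lookup; reverse-involutive; length-map; length-tabulate)
  open import Data.List.Membership.Propositional using (_∈_)
  open import Data.List.Membership.Propositional.Properties using (∈-map⁺; ∈-map⁻; ∈-allFin)
  open import Data.List.Membership.Propositional.Properties.WithK using (unique∧set⇒bag)
  open import Data.List.Relation.Unary.Any using (here)
  import Data.List.Relation.Unary.All as All
  open import Data.List.Relation.Unary.Unique.Propositional as Unique using (Unique)
  import Data.List.Relation.Unary.Unique.Propositional.Properties as Unique
  open import Data.List.Relation.Binary.Permutation.Propositional as ↭ using (_↭_; ↭-sym)
  open import Data.List.Relation.Binary.Permutation.Propositional.Properties using (↭-reverse)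
  open import Data.List.Relation.Binary.BagAndSetEquality using (∼bag⇒↭)
  open import Data.Maybe using (just; nothing)
  open import Data.Product using (Σ; _×_; _,_; proj₁; proj₂)
  open import Data.Sum using (inj₁; inj₂)
  open import Data.Unit using (tt)
  open import Data.Empty using (⊥; ⊥-elim)
  open import Function using (_∘_; case_of_; _⇔_; mk⇔; Equivalence)
  import Function.Properties.Equivalence as ⇔
  open import Relation.Nullary using (yes; no)
  open import Relation.Binary.PropositionalEquality
  open Counting
  open FinPermutations
  open Tuples

  private
    n m : ℕ
    n = arity L E
    m = size 𝓜
    Tuple : Set
    Tuple = Fin n → HatM m
    ev : List (Fin n) → Tuple → TV
    ev = evalRev 𝓜 ε E

  -- Kept opaque: unfolded, the rational arithmetic inside exceeds makes with-abstraction over goals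
  -- mentioning votes extremely slow.
  opaque
    vote : Subset m → (Fin m → TV) → TV
    vote X f =
      if exceeds ε (count (λ a → lookup X a ∧ isTT (f a))) ∣ X ∣ then tt
      else if exceeds ε (count (λ a → lookup X a ∧ isFF (f a))) ∣ X ∣ then ff
      else undet

  opaque
    unfolding vote

    vote-unfold : ∀ X f → vote X f ≡ (if exceeds ε (count (λ a → lookup X a ∧ isTT (f a))) ∣ X ∣ then tt
      else if exceeds ε (count (λ a → lookup X a ∧ isFF (f a))) ∣ X ∣ then ff else undet)
    vote-unfold X f = refl

    vote-cong : ∀ X {f g} → f ≗ g → vote X f ≡ vote X g
    vote-cong X f≗g = cong₂ (λ t u → if exceeds ε t ∣ X ∣ then tt else if exceeds ε u ∣ X ∣ then ff else undet)
      (count-cong (λ a → cong (λ v → lookup X a ∧ isTT v) (f≗g a)))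
      (count-cong (λ a → cong (λ v → lookup X a ∧ isFF v) (f≗g a)))

    vote≡tt : ∀ X f → vote X f ≡ tt → exceeds ε (count (λ a → lookup X a ∧ isTT (f a))) ∣ X ∣ ≡ true
    vote≡tt X f _ with exceeds ε (count (λ a → lookup X a ∧ isTT (f a))) ∣ X ∣
                     | exceeds ε (count (λ a → lookup X a ∧ isFF (f a))) ∣ X ∣
    vote≡tt X f _  | true  | _     = refl
    vote≡tt X f () | false | true
    vote≡tt X f () | false | false

    vote≡ff : ∀ X f → vote X f ≡ ff → exceeds ε (count (λ a → lookup X a ∧ isFF (f a))) ∣ X ∣ ≡ true
    vote≡ff X f _ with exceeds ε (count (λ a → lookup X a ∧ isTT (f a))) ∣ X ∣
                     | exceeds ε (count (λ a → lookup X a ∧ isFF (f a))) ∣ X ∣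
    vote≡ff X f () | true  | _
    vote≡ff X f _  | false | true  = refl
    vote≡ff X f () | false | false

  evalRev-cons : ∀ {j ks C X} → SetPositions (j ∷ ks) C → C j ≡ inj₂ X →
    ev (j ∷ ks) C ≡ vote X (λ a → ev ks (update C j (inj₁ a)))
  evalRev-cons {j} {ks} {C} sp Cj≡X with sameS (j ∷ ks) C | sameS-true sp
  ... | .true | refl with C j | Cj≡X
  ...   | .(inj₂ _) | refl = sym (vote-unfold _ _)

  evalRev-[]-determinate : ∀ {C} → SetPositions [] C → Determinate (ev [] C)
  evalRev-[]-determinate {C} sp with sameS [] C | sameS-true sp
  ... | .true | refl with elems C | elems-total C (λ i set → case Equivalence.from (sp i) set of λ ())
  ...   | _ | f , refl = if-determinate (rel 𝓜 E f)
    where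
    if-determinate : ∀ b → Determinate (if b then tt else ff)
    if-determinate true  = tt
    if-determinate false = tt

  evalRev-cong : ∀ ks {C D : Tuple} → C ≗ D → ev ks C ≡ ev ks D
  evalRev-cong ks {C} {D} C≗D with sameS ks C | sameS ks D | sameS-cong ks C≗D
  ... | false | .false | refl = refl
  evalRev-cong [] {C} {D} C≗D | true | .true | refl with elems C | elems D | elems-cong C≗D
  ... | just f  | .(just f) | refl = refl
  ... | nothing | .nothing  | refl = refl
  evalRev-cong (j ∷ ks) {C} {D} C≗D | true | .true | refl with C j | D j | C≗D j
  ... | inj₁ _ | _ | refl = refl
  ... | inj₂ X | _ | refl = begin
    _                                            ≡⟨ vote-unfold X _ ⟨
    vote X (λ a → ev ks (update C j (inj₁ a)))   ≡⟨ vote-cong X (λ a → evalRev-cong ks (update-cong j (inj₁ a) C≗D)) ⟩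
    vote X (λ a → ev ks (update D j (inj₁ a)))   ≡⟨ vote-unfold X _ ⟩
    _                                            ∎
    where open ≡-Reasoning

  evalRev-head-cong : ∀ {j ks ks′ C} → SetPositions (j ∷ ks) C → SetPositions (j ∷ ks′) C →
    (∀ a → ev ks (update C j (inj₁ a)) ≡ ev ks′ (update C j (inj₁ a))) → ev (j ∷ ks) C ≡ ev (j ∷ ks′) C
  evalRev-head-cong {j} {ks} {ks′} {C} sp sp′ tails-agree = begin
    ev (j ∷ ks) C                                ≡⟨ evalRev-cons sp Cj≡X ⟩
    vote X (λ a → ev ks (update C j (inj₁ a)))   ≡⟨ vote-cong X tails-agree ⟩
    vote X (λ a → ev ks′ (update C j (inj₁ a)))  ≡⟨ evalRev-cons sp′ Cj≡X ⟨
    ev (j ∷ ks′) C                               ∎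
    where
    open ≡-Reasoning
    X : Subset m
    X = proj₁ (SetPositions-head sp)
    Cj≡X : C j ≡ inj₂ X
    Cj≡X = proj₂ (SetPositions-head sp)

  evalRev-cons₂ : ∀ {K x y rest C X Y} → Admissible K C (x ∷ y ∷ rest) → C x ≡ inj₂ X → C y ≡ inj₂ Y →
    ev (x ∷ y ∷ rest) C ≡ vote X (λ a → vote Y (λ b → ev rest (update (update C x (inj₁ a)) y (inj₁ b))))
  evalRev-cons₂ {x = x} {y} {C = C} adm Cx≡X Cy≡Y = trans (evalRev-cons (positions adm) Cx≡X) (vote-cong _ (λ a →
    evalRev-cons (positions (Admissible-tail adm a)) (trans (update-≢ C (inj₁ a) (x≢y ∘ sym)) Cy≡Y)))
    where
    x≢y : x ≢ y
    x≢y = All.head (Unique.head (unique adm))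

  goodF-fuel : ∀ {f f′ k v} → k ≤ f → k ≤ f′ → goodF 𝓜 ε E f k v → goodF 𝓜 ε E f′ k v
  goodF-fuel {k = zero} _ _ good = good
  goodF-fuel {suc f} {suc f′} {suc k} (s≤s k≤f) (s≤s k≤f′) (lower , upper) =
    (λ k′ 1≤k′ k′<1+k → goodF-fuel (≤-trans (≤-pred k′<1+k) k≤f) (≤-trans (≤-pred k′<1+k) k≤f′)
      (lower k′ 1≤k′ k′<1+k)) ,
    (λ Â Â₀ inner outer σ → upper Â Â₀
      (λ i 1≤i i<1+k → proj₁ (inner i 1≤i i<1+k) ,
        goodF-fuel (≤-trans (∸-monoʳ-≤ (suc k) 1≤i) k≤f′) (≤-trans (∸-monoʳ-≤ (suc k) 1≤i) k≤f)
          (proj₂ (inner i 1≤i i<1+k)))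
      outer σ)

  Good-downward : ∀ {k K v} → 1 ≤ k → k ≤ K → Good 𝓜 ε E K v → Good 𝓜 ε E k v
  Good-downward {K = zero} 1≤k k≤0 _ = ⊥-elim (<⇒≱ 1≤k k≤0)
  Good-downward {k} {suc K} 1≤k k≤1+K good with m≤n⇒m<n∨m≡n k≤1+K
  ... | inj₂ refl  = good
  ... | inj₁ k<1+K = goodF-fuel (≤-pred k<1+K) ≤-refl (proj₁ good k 1≤k k<1+K)

  SetsGood : ℕ → Tuple → Set
  SetsGood K C = ∀ i → IsSet (C i) → Good 𝓜 ε E K (C i)

  SetsGood-update : ∀ {K C} j a → SetsGood K C → SetsGood K (update C j (inj₁ a))
  SetsGood-update j a good i with i ≟ j
  ... | yes _ = λ ()
  ... | no _  = good i

  below-tabulate : ∀ {K} (K≤n : K ≤ n) → below 𝓜 ε E K ≡ tabulate (λ t → inject≤ t K≤n)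
  below-tabulate {K} K≤n = filter-<-tabulate (λ i → i) 0 K K≤n (λ _ → refl)

  -- The goodness of the outermost set C j, instantiated with a permutation ρ listing ks first.
  good⇒determinate : ∀ {K C ks} → K ≤ n → SetsGood K C → Admissible K C ks → Determinate (ev ks C)
  good⇒determinate {ks = []} _ _ adm = evalRev-[]-determinate (positions adm)
  good⇒determinate {K} {C} {ks@(j ∷ r)} K≤n good adm =
    subst Determinate same-evaluation
      (proj₂ (Good-downward (s≤s z≤n) (bounded adm) (good j set-j)) Â Â₀ inner outer ρ)
    where
    ks≤n : length ks ≤ n
    ks≤n = ≤-trans (bounded adm) K≤n
    extension : Σ (Permutation′ n) λ ρ → ∀ t → ρ ⟨$⟩ʳ inject≤ t ks≤n ≡ List.lookup ks t
    extension = extend-injection ks≤n (List.lookup ks) (lookup-injective (unique adm))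
    ρ : Permutation′ n
    ρ = proj₁ extension
    Â : Tuple
    Â i = C (ρ ⟨$⟩ʳ i)
    set-j : IsSet (C j)
    set-j = Equivalence.to (positions adm j) (here refl)
    set⇔front : ∀ i → IsSet (Â i) ⇔ toℕ i < length ks
    set⇔front i = ⇔.trans (⇔.sym (positions adm (ρ ⟨$⟩ʳ i))) (extends-∈⇔ ks≤n ρ (proj₂ extension) i)
    Â₀ : ∀ i → toℕ i ≡ 0 → Â i ≡ C j
    Â₀ i i≡0 = cong C (trans (cong (ρ ⟨$⟩ʳ_) (toℕ-injective (trans i≡0 (sym (toℕ-inject≤ zero ks≤n)))))
      (proj₂ extension zero))
    inner : ∀ i → 1 ≤ toℕ i → toℕ i < length ks →
      IsSet (Â i) × goodF 𝓜 ε E (length r) (length ks ∸ toℕ i) (Â i)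
    inner i 1≤i i<ks = set-i , goodF-fuel ≤-refl (∸-monoʳ-≤ (length ks) 1≤i)
      (Good-downward (m<n⇒0<n∸m i<ks) (≤-trans (m∸n≤m (length ks) (toℕ i)) (bounded adm))
        (good (ρ ⟨$⟩ʳ i) set-i))
      where
      set-i : IsSet (Â i)
      set-i = Equivalence.from (set⇔front i) i<ks
    outer : ∀ i → length ks ≤ toℕ i → IsElem (Â i)
    outer i ks≤i = ¬IsSet⇒IsElem (Â i) (λ set → <⇒≱ (Equivalence.to (set⇔front i) set) ks≤i)
    same-evaluation :
      hatE 𝓜 ε E (reverse (map (ρ ⟨$⟩ʳ_) (below 𝓜 ε E (length ks)))) (permute 𝓜 ε E ρ Â) ≡ ev ks C
    same-evaluation = begin
      ev (reverse (reverse (map (ρ ⟨$⟩ʳ_) (below 𝓜 ε E (length ks))))) (permute 𝓜 ε E ρ Â)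
        ≡⟨ cong (λ ks′ → ev ks′ (permute 𝓜 ε E ρ Â)) (reverse-involutive _) ⟩
      ev (map (ρ ⟨$⟩ʳ_) (below 𝓜 ε E (length ks))) (permute 𝓜 ε E ρ Â)
        ≡⟨ cong (λ ks′ → ev (map (ρ ⟨$⟩ʳ_) ks′) (permute 𝓜 ε E ρ Â)) (below-tabulate ks≤n) ⟩
      ev (map (ρ ⟨$⟩ʳ_) (tabulate (λ t → inject≤ t ks≤n))) (permute 𝓜 ε E ρ Â)
        ≡⟨ cong (λ ks′ → ev ks′ (permute 𝓜 ε E ρ Â))
             (trans (map-tabulate (λ t → inject≤ t ks≤n) (ρ ⟨$⟩ʳ_))
               (trans (tabulate-cong (proj₂ extension)) (tabulate-lookup ks))) ⟩
      ev ks (permute 𝓜 ε E ρ Â)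
        ≡⟨ evalRev-cong ks (λ c → cong C (inverseʳ ρ)) ⟩
      ev ks C ∎
      where open ≡-Reasoning

  compTuple-admissible : ∀ {ℓ} (ℓ≤n : ℓ ≤ n) (σ : Permutation′ n) {A : Tuple} →
    (∀ i → IsSet (A i) ⇔ toℕ i < ℓ) → ∀ β → Admissible ℓ (permute 𝓜 ε E σ A) (reverse (compTuple 𝓜 ε E ℓ ℓ≤n σ β))
  compTuple-admissible {ℓ} ℓ≤n σ {A} set⇔front β = Admissible-↭ (↭-sym (↭-reverse (map position (allFin ℓ)))) (record
    { unique    = Unique.map⁺ (λ eq → ⟨$⟩ʳ-injective β (inject≤-injective ℓ≤n ℓ≤n _ _ (⟨$⟩ʳ-injective σ eq)))
                    (Unique.allFin⁺ ℓ)
    ; positions = λ c → ⇔.trans (mk⇔ listed⇒front front⇒listed) (⇔.sym (set⇔front (σ ⟨$⟩ˡ c)))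
    ; bounded   = ≤-reflexive (trans (length-map position (allFin ℓ)) (length-tabulate (λ i → i)))
    })
    where
    position : Fin ℓ → Fin n
    position t = σ ⟨$⟩ʳ inject≤ (β ⟨$⟩ʳ t) ℓ≤n
    listed⇒front : ∀ {c} → c ∈ map position (allFin ℓ) → toℕ (σ ⟨$⟩ˡ c) < ℓ
    listed⇒front c∈ with ∈-map⁻ position c∈
    ... | t , _ , refl = subst (_< ℓ) (cong toℕ (sym (inverseˡ σ))) (toℕ-inject≤-< (β ⟨$⟩ʳ t) ℓ≤n)
    front⇒listed : ∀ {c} → toℕ (σ ⟨$⟩ˡ c) < ℓ → c ∈ map position (allFin ℓ)
    front⇒listed {c} c<ℓ =
      subst (_∈ map position (allFin ℓ)) lands (∈-map⁺ position (∈-allFin (β ⟨$⟩ˡ fromℕ< c<ℓ)))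
      where
      lands : position (β ⟨$⟩ˡ fromℕ< c<ℓ) ≡ c
      lands = trans (cong (λ t → σ ⟨$⟩ʳ inject≤ t ℓ≤n) (inverseʳ β))
        (trans (cong (σ ⟨$⟩ʳ_) (inject≤-fromℕ< (σ ⟨$⟩ˡ c) c<ℓ ℓ≤n)) (inverseʳ σ))

  module Exchange (exceeds⇒ : ∀ k c → exceeds ε k c ≡ true → 3 * c < 4 * k) where

    vote-tt⇒ : ∀ X f → vote X f ≡ tt → ThreeQuarters X (isTT ∘ f)
    vote-tt⇒ X f voted = exceeds⇒ (count (λ a → lookup X a ∧ isTT (f a))) ∣ X ∣ (vote≡tt X f voted)

    vote-ff⇒ : ∀ X f → vote X f ≡ ff → ThreeQuarters X (isFF ∘ f)
    vote-ff⇒ X f voted = exceeds⇒ (count (λ a → lookup X a ∧ isFF (f a))) ∣ X ∣ (vote≡ff X f voted)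

    vote-no-clash : ∀ X Y (φ : Fin m → Fin m → TV) →
      vote X (λ a → vote Y (φ a)) ≡ tt → vote Y (λ b → vote X (λ a → φ a b)) ≡ ff → ⊥
    vote-no-clash X Y φ rows-tt columns-ff = ThreeQuarters-exchange X Y
      (λ a b → isTT (φ a b)) (λ a b → isFF (φ a b))
      (λ a → isTT (vote Y (φ a))) (λ b → isFF (vote X (λ a → φ a b)))
      (λ a b → isTT∧isFF (φ a b))
      (vote-tt⇒ X _ rows-tt) (λ a row-tt → vote-tt⇒ Y (φ a) (isTT-sound row-tt))
      (vote-ff⇒ Y _ columns-ff) (λ b column-ff → vote-ff⇒ X (λ a → φ a b) (isFF-sound column-ff))
      where
      isTT∧isFF : ∀ v → isTT v ∧ isFF v ≡ false
      isTT∧isFF tt    = refl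
      isTT∧isFF ff    = refl
      isTT∧isFF undet = refl
      isTT-sound : ∀ {v} → isTT v ≡ true → v ≡ tt
      isTT-sound {tt} _ = refl
      isFF-sound : ∀ {v} → isFF v ≡ true → v ≡ ff
      isFF-sound {ff} _ = refl

    vote-exchange : ∀ X Y (φ : Fin m → Fin m → TV) →
      Determinate (vote X (λ a → vote Y (φ a))) → Determinate (vote Y (λ b → vote X (λ a → φ a b))) →
      vote X (λ a → vote Y (φ a)) ≡ vote Y (λ b → vote X (λ a → φ a b))
    vote-exchange X Y φ rows-determinate columns-determinate
      with vote X (λ a → vote Y (φ a)) in rows | vote Y (λ b → vote X (λ a → φ a b)) in columns
    ... | undet | _     = ⊥-elim rows-determinate
    ... | _     | undet = ⊥-elim columns-determinate
    ... | tt | tt = refl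
    ... | ff | ff = refl
    ... | tt | ff = ⊥-elim (vote-no-clash X Y φ rows columns)
    ... | ff | tt = ⊥-elim (vote-no-clash Y X (λ b a → φ a b) columns rows)

    evalRev-swap : ∀ {K C x y rest} → K ≤ n → SetsGood K C → Admissible K C (x ∷ y ∷ rest) →
      ev (x ∷ y ∷ rest) C ≡ ev (y ∷ x ∷ rest) C
    evalRev-swap {K} {C} {x} {y} {rest} K≤n good adm = begin
      ev (x ∷ y ∷ rest) C                    ≡⟨ unfolded ⟩
      vote X (λ a → vote Y (φ a))
        ≡⟨ vote-exchange X Y φ (subst Determinate unfolded (good⇒determinate K≤n good adm))
                               (subst Determinate swapped (good⇒determinate K≤n good adm′)) ⟩
      vote Y (λ b → vote X (λ a → φ a b))    ≡⟨ swapped ⟨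
      ev (y ∷ x ∷ rest) C                    ∎
      where
      open ≡-Reasoning
      adm′ : Admissible K C (y ∷ x ∷ rest)
      adm′ = Admissible-↭ (↭.swap x y ↭.refl) adm
      X Y : Subset m
      X = proj₁ (SetPositions-head (positions adm))
      Y = proj₁ (SetPositions-head (positions adm′))
      Cx≡X : C x ≡ inj₂ X
      Cx≡X = proj₂ (SetPositions-head (positions adm))
      Cy≡Y : C y ≡ inj₂ Y
      Cy≡Y = proj₂ (SetPositions-head (positions adm′))
      φ : Fin m → Fin m → TV
      φ a b = ev rest (update (update C x (inj₁ a)) y (inj₁ b))
      unfolded : ev (x ∷ y ∷ rest) C ≡ vote X (λ a → vote Y (φ a))
      unfolded = evalRev-cons₂ adm Cx≡X Cy≡Y
      swapped : ev (y ∷ x ∷ rest) C ≡ vote Y (λ b → vote X (λ a → φ a b))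
      swapped = trans (evalRev-cons₂ adm′ Cy≡Y Cx≡X) (vote-cong Y (λ b → vote-cong X (λ a →
          evalRev-cong rest (update-comm C (inj₁ b) (inj₁ a) (All.head (Unique.head (unique adm′)))))))

    evalRev-↭ : ∀ {K C ks ks′} → K ≤ n → SetsGood K C → Admissible K C ks → ks ↭ ks′ → ev ks C ≡ ev ks′ C
    evalRev-↭ _ _ _ ↭.refl = refl
    evalRev-↭ {K} K≤n good adm (↭.prep x p) =
      evalRev-head-cong (positions adm) (positions (Admissible-↭ (↭.prep x p) adm)) (λ a →
        evalRev-↭ K≤n (SetsGood-update {K} x a good) (Admissible-tail adm a) p)
    evalRev-↭ {K} {C} {_ ∷ _ ∷ xs} {_ ∷ _ ∷ ys} K≤n good adm (↭.swap x y p) = trans (evalRev-swap K≤n good adm)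
      (evalRev-head-cong (positions yx) (positions yx′) (λ b →
        evalRev-head-cong (positions (Admissible-tail yx b)) (positions (Admissible-tail yx′ b)) (λ a →
          evalRev-↭ K≤n (SetsGood-update {K} x a (SetsGood-update {K} y b good))
            (Admissible-tail (Admissible-tail yx b) a) p)))
      where
      yx : Admissible K C (y ∷ x ∷ xs)
      yx = Admissible-↭ (↭.swap x y ↭.refl) adm
      yx′ : Admissible K C (y ∷ x ∷ ys)
      yx′ = Admissible-↭ (↭.swap x y p) adm
    evalRev-↭ K≤n good adm (↭.trans p q) =
      trans (evalRev-↭ K≤n good adm p) (evalRev-↭ K≤n good (Admissible-↭ p adm) q)

    -- Two duplicate-free lists with the same elements are permutations of each other.
    order-independent : ∀ {K C ks ks′} → K ≤ n → SetsGood K C → Admissible K C ks → Admissible K C ks′ →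
      ev ks C ≡ ev ks′ C
    order-independent K≤n good adm adm′ = evalRev-↭ K≤n good adm (∼bag⇒↭ (unique∧set⇒bag (unique adm) (unique adm′)
      (λ {i} → ⇔.trans (positions adm i) (⇔.sym (positions adm′ i)))))

open import Data.Nat using (ℕ; _≤_)
open import Data.Fin using (Fin; toℕ)
open import Data.Fin.Permutation using (Permutation′)
open import Data.Integer using (+_)
open import Data.Rational using (ℚ; _/_; _<_; 0ℚ)
open import Data.Product using (_×_; _,_; proj₁; proj₂)
open import Relation.Binary.PropositionalEquality using (_≡_)
open import Data.List using (reverse)
open import Function using (_∘_; _⇔_; Equivalence)
open Threshold using (exceeds⇒three-quarters)
open Tuples using (Admissible; IsSet⇔front)

mainTheorem5 : (L : Language) (𝓜 : Structure L) (E : Fin (nsym L)) (ε : ℚ) →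
    0ℚ < ε → ε < (+ 1) / 4 →
    (ℓ : ℕ) → 1 ≤ ℓ → (ℓ≤n : ℓ ≤ arity L E) →
    (A : Fin (arity L E) → HatM (size 𝓜)) →
    ((i : Fin (arity L E)) → toℕ i Data.Nat.< ℓ → IsSet (A i) × Good 𝓜 ε E ℓ (A i)) →
    ((i : Fin (arity L E)) → ℓ ≤ toℕ i → IsElem (A i)) →
    (σ : Permutation′ (arity L E)) →
    (β₀ β₁ : Permutation′ ℓ) →
    (hatE 𝓜 ε E (compTuple 𝓜 ε E ℓ ℓ≤n σ β₀) (permute 𝓜 ε E σ A)
       ≡ hatE 𝓜 ε E (compTuple 𝓜 ε E ℓ ℓ≤n σ β₁) (permute 𝓜 ε E σ A))
    × Determinate (hatE 𝓜 ε E (compTuple 𝓜 ε E ℓ ℓ≤n σ β₀) (permute 𝓜 ε E σ A))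
mainTheorem5 L 𝓜 E ε _ ε<¼ ℓ _ ℓ≤n A front back σ β₀ β₁ =
  order-independent ℓ≤n good (admissible β₀) (admissible β₁) , good⇒determinate ℓ≤n good (admissible β₀)
  where
  open Evaluation 𝓜 ε E
  open Exchange (exceeds⇒three-quarters ε<¼)
  sets-in-front : ∀ i → IsSet (A i) ⇔ toℕ i Data.Nat.< ℓ
  sets-in-front = IsSet⇔front (λ i → proj₁ ∘ front i) back
  good : SetsGood ℓ (permute 𝓜 ε E σ A)
  good c set = proj₂ (front _ (Equivalence.to (sets-in-front _) set))
  admissible : ∀ β → Admissible ℓ (permute 𝓜 ε E σ A) (reverse (compTuple 𝓜 ε E ℓ ℓ≤n σ β))
  admissible = compTuple-admissible ℓ≤n σ sets-in-front
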